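{- Let $A$ and $B$ be disjoint subsets of $[n]$. The independence model $A\perp\!\!\!\perp B$, i.e. the set of distributions $P$ whose moment generating function has the form $M(x)=M_1(x_i:i\in A)\cdot M_2(x_j:j\in B)+\sum_{l\in[n]\setminus(A\cup B)}x_l\,N_l(x)$ for some polynomials $M_1,M_2,N_l$, is defined by the equations $k_I=0$ for all $I\subseteq A\cup B$ with $I\cap A\neq\emptyset$ and $I\cap B\neq\emptyset$.
   Context: A distribution is a complex table $P=(p_I)_{I\subseteq[n]}$ with $\sum_Ip_I=1$. Moments: $\mu_I=\sum_{J\supseteq I}p_J$; moment generating function $M(x)=\sum_I\mu_I\prod_{i\in I}x_i$ (a square-free polynomial with constant term $1$). Cumulants $k_I$: the coefficients of $K(x)=\sum_Ik_I\prod_{i\in I}x_i=\log M(x)$, computed with $\log(1+t)=\sum_{j\ge1}(-1)^{j-1}t^j/j$ modulo $\langle x_1^2,\ldots,x_n^2\rangle$. All polynomials in $x$ are considered modulo $\langle x_1^2,\ldots,x_n^2\rangle$. -}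

module Defs where

open import Level using (_⊔_) renaming (suc to lsuc)
open import Algebra.Bundles using (CommutativeRing)
open import Data.Nat using (ℕ; zero; suc)
open import Data.Bool using (if_then_else_)
open import Data.Fin using (Fin)
open import Data.Fin.Subset using (Subset; inside; outside; _∈_; _∉_; _⊆_; _∩_; _∪_; _─_; Nonempty; Empty; ⁅_⁆)
open import Data.Fin.Subset.Properties using (_⊆?_; _∈?_; nonempty?)
open import Data.List using (List; []; _∷_; map; _++_; foldr; allFin)
open import Data.Vec using ([]; _∷_)
open import Relation.Nullary using (does; ¬_)
open import Data.Product using (Σ; _×_)

natR : ∀ {c ℓ} (R : CommutativeRing c ℓ) → ℕ → CommutativeRing.Carrier R
natR R zero = CommutativeRing.0# R
natR R (suc k) = CommutativeRing._+_ R (CommutativeRing.1# R) (natR R k)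

-- A "Q-algebra": a commutative ring in which every positive integer is invertible.
-- (Complex numbers are not available in agda-stdlib; ℂ is an instance.)
record QAlgebra (c ℓ : Level.Level) : Set (lsuc (c ⊔ ℓ)) where
  field
    cring : CommutativeRing c ℓ
  open CommutativeRing cring
  field
    inv    : ℕ → Carrier
    inv-law : ∀ k → inv (suc k) * natR cring (suc k) ≈ 1#

allSubsets : ∀ n → List (Subset n)
allSubsets zero = [] ∷ []
allSubsets (suc n) = map (inside ∷_) (allSubsets n) ++ map (outside ∷_) (allSubsets n)

module Theory {c ℓ} (Q : QAlgebra c ℓ) where
  open QAlgebra Q public using (cring; inv)
  open CommutativeRing cring

  sumR : List Carrier → Carrier
  sumR = foldr _+_ 0#

  ΣS : ∀ {n} → (Subset n → Carrier) → Carrier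
  ΣS {n} f = sumR (map f (allSubsets n))

  -- square-free polynomials in x₁..xₙ (i.e. polynomials modulo ⟨x₁²,…,xₙ²⟩),
  -- represented by their coefficient function I ↦ coefficient of ∏_{i∈I} x_i
  Poly : ℕ → Set c
  Poly n = Subset n → Carrier

  _≈P_ : ∀ {n} → Poly n → Poly n → Set ℓ
  f ≈P g = ∀ I → f I ≈ g I

  0P : ∀ {n} → Poly n
  0P _ = 0#

  1P : ∀ {n} → Poly n
  1P I = if does (nonempty? I) then 0# else 1#

  _+P_ : ∀ {n} → Poly n → Poly n → Poly n
  (f +P g) I = f I + g I

  -P_ : ∀ {n} → Poly n → Poly n
  (-P f) I = - f I

  scaleP : ∀ {n} → Carrier → Poly n → Poly n
  scaleP a f I = a * f I

  _*P_ : ∀ {n} → Poly n → Poly n → Poly n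
  (f *P g) I = ΣS (λ J → if does (J ⊆? I) then f J * g (I ─ J) else 0#)

  _^P_ : ∀ {n} → Poly n → ℕ → Poly n
  f ^P zero = 1P
  f ^P suc k = f *P (f ^P k)

  xMul : ∀ {n} → Fin n → Poly n → Poly n
  xMul l f I = if does (l ∈? I) then f (I ─ ⁅ l ⁆) else 0#

  InVars : ∀ {n} → Subset n → Poly n → Set ℓ
  InVars A f = ∀ I → ¬ (I ⊆ A) → f I ≈ 0#

  IsDistribution : ∀ {n} → (Subset n → Carrier) → Set ℓ
  IsDistribution p = ΣS p ≈ 1#

  moment : ∀ {n} → (Subset n → Carrier) → Subset n → Carrier
  moment p I = ΣS (λ J → if does (I ⊆? J) then p J else 0#)

  mgf : ∀ {n} → (Subset n → Carrier) → Poly n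
  mgf p = moment p

  sgn : ℕ → Carrier
  sgn zero = 1#
  sgn (suc zero) = 1#
  sgn (suc (suc k)) = - sgn (suc k)

  -- log M = Σ_{j≥1} (-1)^(j-1) (M-1)^j / j  modulo ⟨x₁²,…,xₙ²⟩.
  -- Since M - 1 has zero constant term, (M-1)^j ≡ 0 for j > n, so the
  -- series is the finite sum over j = 1..n.
  logSeries : ∀ {n} → Poly n → ℕ → Poly n
  logSeries f zero = 0P
  logSeries f (suc j) = scaleP (sgn (suc j) * inv (suc j)) ((f +P (-P 1P)) ^P suc j) +P logSeries f j

  logP : ∀ {n} → Poly n → Poly n
  logP {n} f = logSeries f n

  cumulant : ∀ {n} → (Subset n → Carrier) → Subset n → Carrier
  cumulant p = logP (mgf p)

  outsideSum : ∀ {n} → Subset n → (Fin n → Poly n) → Poly n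
  outsideSum {n} C N I = sumR (map (λ l → if does (l ∈? C) then 0# else xMul l (N l) I) (allFin n))

  InIndependenceModel : ∀ {n} → Subset n → Subset n → (Subset n → Carrier) → Set (c ⊔ ℓ)
  InIndependenceModel {n} A B p =
    IsDistribution p ×
    Σ (Poly n) λ M₁ → Σ (Poly n) λ M₂ → Σ (Fin n → Poly n) λ N →
      InVars A M₁ × InVars B M₂ ×
      (mgf p ≈P ((M₁ *P M₂) +P outsideSum (A ∪ B) N))

-- Split a square-free polynomial in its first variable, f = f₀ + x₀ f₁. Since x₀² = 0,
-- log f = log f₀ + x₀ f₁ / f₀, so "h = log f" has a recursive characterisation that avoids
-- the power series; from it, log turns products into sums, is injective, and commutes with
-- setting a set of variables to 0. The truncated series defining the cumulants satisfies it
-- because M − 1 is nilpotent.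
-- If M = M₁ M₂ + Σ_{l ∉ A ∪ B} x_l N_l, setting the variables outside A ∪ B to 0 leaves M₁ M₂,
-- whose logarithm log M₁ + log M₂ has no mixed coefficients. Conversely, vanishing mixed
-- cumulants give K|_{A ∪ B} = K|_A + K|_B, hence M|_{A ∪ B} = M|_A M|_B, and the remaining
-- monomials of M each contain a variable outside A ∪ B.

module Submission where

open import Defs
open import Algebra.Bundles using (CommutativeRing)
import Algebra.Properties.Ring as RingProperties
import Algebra.Properties.CommutativeSemigroup as CommutativeSemigroupProperties
import Relation.Binary.Reasoning.Setoid as SetoidReasoning
open import Data.Nat using (ℕ; zero; suc)
open import Data.Fin using (Fin; zero; suc)
open import Data.Fin.Properties using (any?)
open import Data.Fin.Subset using (Subset; inside; outside; _⊆_; _∩_; _∪_; _─_; Nonempty; Empty) renaming (⊥ to ∅)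
open import Data.Fin.Subset.Properties using (_⊆?_; _∈?_; nonempty?; out⊆; in⊆in; x∈p∩q⁺; x∈p∩q⁻; x∈p∪q⁻; Empty-unique; ⊥⊆; p⊆p∪q; q⊆p∪q)
open import Data.Bool using (Bool; true; false; if_then_else_; _∨_)
open import Data.Vec using ([]; _∷_)
open import Data.List using ([]; _∷_; map; _++_; allFin)
open import Data.List.Properties using (map-++; map-∘; map-tabulate)
open import Data.Product using (Σ; _×_; _,_; proj₁; proj₂)
open import Data.Sum using (inj₁; inj₂)
open import Data.Empty using (⊥-elim)
open import Function using (_∘_)
open import Relation.Nullary using (¬_; Dec; yes; no; does)
open import Relation.Nullary.Decidable using (dec-true)
open import Relation.Binary.PropositionalEquality as ≡ using (_≡_)

module RingIdentities {c ℓ} (R : CommutativeRing c ℓ) where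
  open CommutativeRing R
  open SetoidReasoning setoid
  open RingProperties ring using (-‿distribʳ-*)
  open CommutativeSemigroupProperties *-commutativeSemigroup using (x∙yz≈y∙xz)
  open CommutativeSemigroupProperties +-commutativeSemigroup using (interchange)

  unit-cancelˡ : ∀ {u a x y} → u * a ≈ 1# → a * x ≈ a * y → x ≈ y
  unit-cancelˡ {u} {a} {x} {y} ua≈1 ax≈ay = begin
    x             ≈⟨ *-identityˡ x ⟨
    1# * x        ≈⟨ *-congʳ ua≈1 ⟨
    (u * a) * x   ≈⟨ *-assoc u a x ⟩
    u * (a * x)   ≈⟨ *-congˡ ax≈ay ⟩
    u * (a * y)   ≈⟨ *-assoc u a y ⟨
    (u * a) * y   ≈⟨ *-congʳ ua≈1 ⟩
    1# * y        ≈⟨ *-identityˡ y ⟩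
    y             ∎

  inverse-derivative : ∀ {a u} b → a * u ≈ 1# → a * - (b * u * u) + b * u ≈ 0#
  inverse-derivative {a} {u} b au≈1 = begin
    a * - (b * u * u) + b * u   ≈⟨ +-congʳ (-‿distribʳ-* a (b * u * u)) ⟨
    - (a * (b * u * u)) + b * u ≈⟨ +-congʳ (-‿cong (x∙yz≈y∙xz a (b * u) u)) ⟩
    - (b * u * (a * u)) + b * u ≈⟨ +-congʳ (-‿cong (trans (*-congˡ au≈1) (*-identityʳ (b * u)))) ⟩
    - (b * u) + b * u           ≈⟨ -‿inverseˡ (b * u) ⟩
    0#                          ∎

  geometric-step : ∀ u y g → (1# + u) * g ≈ 1# + y → (1# + u) * (- y + g) ≈ 1# + - (u * y)
  geometric-step u y g step = begin
    (1# + u) * (- y + g)                  ≈⟨ distribˡ (1# + u) (- y) g ⟩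
    (1# + u) * - y + (1# + u) * g         ≈⟨ +-cong (distribʳ (- y) 1# u) step ⟩
    (1# * - y + u * - y) + (1# + y)       ≈⟨ +-cong (+-cong (*-identityˡ (- y)) (sym (-‿distribʳ-* u y))) (+-comm 1# y) ⟩
    (- y + - (u * y)) + (y + 1#)          ≈⟨ interchange (- y) (- (u * y)) y 1# ⟩
    (- y + y) + (- (u * y) + 1#)          ≈⟨ +-cong (-‿inverseˡ y) (+-comm (- (u * y)) 1#) ⟩
    0# + (1# + - (u * y))                 ≈⟨ +-identityˡ _ ⟩
    1# + - (u * y)                        ∎

  product-logDerivative : ∀ a b x y → (a * b) * (x + y) ≈ b * (a * x) + a * (b * y)
  product-logDerivative a b x y = begin
    (a * b) * (x + y)         ≈⟨ distribˡ (a * b) x y ⟩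
    (a * b) * x + (a * b) * y ≈⟨ +-cong (trans (*-congʳ (*-comm a b)) (*-assoc b a x)) (*-assoc a b y) ⟩
    b * (a * x) + a * (b * y) ∎

module Cumulants {c ℓ} (Q : QAlgebra c ℓ) where
  open Theory Q
  open QAlgebra Q using (inv-law)
  open CommutativeRing cring hiding (zero)
  open SetoidReasoning setoid
  open RingProperties ring using (-‿distribˡ-*; -0#≈0#)
  open CommutativeSemigroupProperties +-commutativeSemigroup using (interchange)

  sumR-++ : ∀ xs ys → sumR (xs ++ ys) ≈ sumR xs + sumR ys
  sumR-++ []       ys = sym (+-identityˡ _)
  sumR-++ (x ∷ xs) ys = trans (+-congˡ (sumR-++ xs ys)) (sym (+-assoc _ _ _))

  sumR-cong : ∀ {A : Set} {F G : A → Carrier} xs → (∀ x → F x ≈ G x) → sumR (map F xs) ≈ sumR (map G xs)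
  sumR-cong []       F≈G = refl
  sumR-cong (x ∷ xs) F≈G = +-cong (F≈G x) (sumR-cong xs F≈G)

  sumR-zero : ∀ {A : Set} {F : A → Carrier} xs → (∀ x → F x ≈ 0#) → sumR (map F xs) ≈ 0#
  sumR-zero []       F≈0 = refl
  sumR-zero (x ∷ xs) F≈0 = trans (+-cong (F≈0 x) (sumR-zero xs F≈0)) (+-identityˡ 0#)

  sumR-allFin-suc : ∀ {n} (F : Fin (suc n) → Carrier) →
                    sumR (map F (allFin (suc n))) ≡ F zero + sumR (map (F ∘ suc) (allFin n))
  sumR-allFin-suc {n} F = ≡.cong sumR
    (≡.trans (map-tabulate (λ i → i) F) (≡.sym (≡.cong (F zero ∷_) (map-tabulate (λ i → i) (F ∘ suc)))))

  ΣS-split : ∀ {n} (F : Subset (suc n) → Carrier) → ΣS F ≈ ΣS (F ∘ (inside ∷_)) + ΣS (F ∘ (outside ∷_))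
  ΣS-split {n} F = begin
    sumR (map F (map (inside ∷_) Js ++ map (outside ∷_) Js))
      ≡⟨ ≡.cong sumR (map-++ F (map (inside ∷_) Js) (map (outside ∷_) Js)) ⟩
    sumR (map F (map (inside ∷_) Js) ++ map F (map (outside ∷_) Js))
      ≈⟨ sumR-++ (map F (map (inside ∷_) Js)) (map F (map (outside ∷_) Js)) ⟩
    sumR (map F (map (inside ∷_) Js)) + sumR (map F (map (outside ∷_) Js))
      ≡⟨ ≡.sym (≡.cong₂ (λ xs ys → sumR xs + sumR ys) (map-∘ Js) (map-∘ Js)) ⟩
    ΣS (F ∘ (inside ∷_)) + ΣS (F ∘ (outside ∷_)) ∎
    where
    Js = allSubsets n

  ev₀ ∂₀ : ∀ {n} → Poly (suc n) → Poly n
  ev₀ f I = f (outside ∷ I)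
  ∂₀ f I = f (inside ∷ I)

  _+x₀_ : ∀ {n} → Poly n → Poly n → Poly (suc n)
  (f₀ +x₀ f₁) (outside ∷ I) = f₀ I
  (f₀ +x₀ f₁) (inside ∷ I)  = f₁ I

  ≈P-by-x₀ : ∀ {n} {f g : Poly (suc n)} → ev₀ f ≈P ev₀ g → ∂₀ f ≈P ∂₀ g → f ≈P g
  ≈P-by-x₀ ev₀≈ ∂₀≈ (outside ∷ I) = ev₀≈ I
  ≈P-by-x₀ ev₀≈ ∂₀≈ (inside ∷ I)  = ∂₀≈ I

  ≈P-refl : ∀ {n} {f : Poly n} → f ≈P f
  ≈P-refl I = refl

  ≈P-sym : ∀ {n} {f g : Poly n} → f ≈P g → g ≈P f
  ≈P-sym f≈g I = sym (f≈g I)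

  ≈P-trans : ∀ {n} {f g h : Poly n} → f ≈P g → g ≈P h → f ≈P h
  ≈P-trans f≈g g≈h I = trans (f≈g I) (g≈h I)

  *P-term : ∀ {n} (f g : Poly n) (I J : Subset n) → Carrier
  *P-term f g I J = if does (J ⊆? I) then f J * g (I ─ J) else 0#

  *P-[] : (f g : Poly 0) → (f *P g) [] ≈ f [] * g []
  *P-[] f g = +-identityʳ _

  ev₀-*P : ∀ {n} (f g : Poly (suc n)) → ev₀ (f *P g) ≈P (ev₀ f *P ev₀ g)
  ev₀-*P {n} f g I = begin
    (f *P g) (outside ∷ I)                    ≈⟨ ΣS-split (*P-term f g (outside ∷ I)) ⟩
    ΣS {n} (λ J → 0#) + (ev₀ f *P ev₀ g) I          ≈⟨ +-congʳ (sumR-zero (allSubsets n) (λ J → refl)) ⟩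
    0# + (ev₀ f *P ev₀ g) I                   ≈⟨ +-identityˡ _ ⟩
    (ev₀ f *P ev₀ g) I                        ∎

  ∂₀-*P : ∀ {n} (f g : Poly (suc n)) → ∂₀ (f *P g) ≈P ((ev₀ f *P ∂₀ g) +P (∂₀ f *P ev₀ g))
  ∂₀-*P f g I = trans (ΣS-split (*P-term f g (inside ∷ I))) (+-comm _ _)

  does-any?-cong : ∀ {n} {P R : Fin n → Set} (P? : ∀ i → Dec (P i)) (R? : ∀ i → Dec (R i)) →
                   (∀ i → does (P? i) ≡ does (R? i)) → does (any? P?) ≡ does (any? R?)
  does-any?-cong {zero}  P? R? P≡R = ≡.refl
  does-any?-cong {suc n} P? R? P≡R =
    ≡.cong₂ _∨_ (P≡R zero) (does-any?-cong (P? ∘ suc) (R? ∘ suc) (P≡R ∘ suc))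

  ev₀-1P : ∀ {n} → ev₀ (1P {suc n}) ≈P 1P
  ev₀-1P I = reflexive (≡.cong (λ b → if b then 0# else 1#)
                                 (does-any?-cong (λ i → suc i ∈? (outside ∷ I)) (λ i → i ∈? I) (λ i → ≡.refl)))

  1P-∅ : ∀ n → 1P {n} ∅ ≈ 1#
  1P-∅ zero    = refl
  1P-∅ (suc n) = trans (ev₀-1P {n} ∅) (1P-∅ n)

  *P-cong : ∀ {n} {f f′ g g′ : Poly n} → f ≈P f′ → g ≈P g′ → (f *P g) ≈P (f′ *P g′)
  *P-cong {zero} {f} {f′} {g} {g′} f≈ g≈ [] = trans (*P-[] f g) (trans (*-cong (f≈ []) (g≈ [])) (sym (*P-[] f′ g′)))
  *P-cong {suc n} {f} {f′} {g} {g′} f≈ g≈ = ≈P-by-x₀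
    (λ I → trans (ev₀-*P f g I) (trans (*P-cong (f≈ ∘ (outside ∷_)) (g≈ ∘ (outside ∷_)) I) (sym (ev₀-*P f′ g′ I))))
    (λ I → trans (∂₀-*P f g I) (trans (+-cong (*P-cong (f≈ ∘ (outside ∷_)) (g≈ ∘ (inside ∷_)) I)
                                                (*P-cong (f≈ ∘ (inside ∷_)) (g≈ ∘ (outside ∷_)) I))
                                       (sym (∂₀-*P f′ g′ I))))

  *P-congˡ : ∀ {n} (f : Poly n) {g g′ : Poly n} → g ≈P g′ → (f *P g) ≈P (f *P g′)
  *P-congˡ f g≈ = *P-cong {f = f} ≈P-refl g≈

  *P-congʳ : ∀ {n} (g : Poly n) {f f′ : Poly n} → f ≈P f′ → (f *P g) ≈P (f′ *P g)
  *P-congʳ g f≈ = *P-cong {g = g} f≈ ≈P-refl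

  *P-comm : ∀ {n} (f g : Poly n) → (f *P g) ≈P (g *P f)
  *P-comm {zero} f g [] = trans (*P-[] f g) (trans (*-comm _ _) (sym (*P-[] g f)))
  *P-comm {suc n} f g = ≈P-by-x₀
    (λ I → trans (ev₀-*P f g I) (trans (*P-comm (ev₀ f) (ev₀ g) I) (sym (ev₀-*P g f I))))
    (λ I → trans (∂₀-*P f g I) (trans (+-comm _ _) (trans (+-cong (*P-comm (∂₀ f) (ev₀ g) I) (*P-comm (ev₀ f) (∂₀ g) I))
                                                            (sym (∂₀-*P g f I)))))

  *P-distribˡ : ∀ {n} (f g h : Poly n) → (f *P (g +P h)) ≈P ((f *P g) +P (f *P h))
  *P-distribˡ {zero} f g h [] = trans (*P-[] f (g +P h)) (trans (distribˡ _ _ _) (sym (+-cong (*P-[] f g) (*P-[] f h))))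
  *P-distribˡ {suc n} f g h = ≈P-by-x₀
    (λ I → trans (ev₀-*P f (g +P h) I) (trans (*P-distribˡ (ev₀ f) (ev₀ g) (ev₀ h) I)
             (sym (+-cong (ev₀-*P f g I) (ev₀-*P f h I)))))
    (λ I → trans (∂₀-*P f (g +P h) I)
             (trans (+-cong (*P-distribˡ (ev₀ f) (∂₀ g) (∂₀ h) I) (*P-distribˡ (∂₀ f) (ev₀ g) (ev₀ h) I))
             (trans (interchange _ _ _ _) (sym (+-cong (∂₀-*P f g I) (∂₀-*P f h I))))))

  *P-distribʳ : ∀ {n} (h f g : Poly n) → ((f +P g) *P h) ≈P ((f *P h) +P (g *P h))
  *P-distribʳ h f g I = trans (*P-comm (f +P g) h I) (trans (*P-distribˡ h f g I) (+-cong (*P-comm h f I) (*P-comm h g I)))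

  *P-zeroˡ : ∀ {n} (f : Poly n) → (0P *P f) ≈P 0P
  *P-zeroˡ {zero} f [] = trans (*P-[] 0P f) (zeroˡ _)
  *P-zeroˡ {suc n} f = ≈P-by-x₀
    (λ I → trans (ev₀-*P 0P f I) (*P-zeroˡ (ev₀ f) I))
    (λ I → trans (∂₀-*P 0P f I) (trans (+-cong (*P-zeroˡ (∂₀ f) I) (*P-zeroˡ (ev₀ f) I)) (+-identityˡ 0#)))

  *P-zeroʳ : ∀ {n} (f : Poly n) → (f *P 0P) ≈P 0P
  *P-zeroʳ f I = trans (*P-comm f 0P I) (*P-zeroˡ f I)

  *P-identityˡ : ∀ {n} (f : Poly n) → (1P *P f) ≈P f
  *P-identityˡ {zero} f [] = trans (*P-[] 1P f) (*-identityˡ _)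
  *P-identityˡ {suc n} f = ≈P-by-x₀
    (λ I → trans (ev₀-*P 1P f I) (trans (*P-congʳ (ev₀ f) ev₀-1P I) (*P-identityˡ (ev₀ f) I)))
    (λ I → trans (∂₀-*P 1P f I) (trans (+-cong (trans (*P-congʳ (∂₀ f) ev₀-1P I) (*P-identityˡ (∂₀ f) I))
                                                (*P-zeroˡ (ev₀ f) I))
                                        (+-identityʳ _)))

  *P-identityʳ : ∀ {n} (f : Poly n) → (f *P 1P) ≈P f
  *P-identityʳ f I = trans (*P-comm f 1P I) (*P-identityˡ f I)

  *P-assoc : ∀ {n} (f g h : Poly n) → ((f *P g) *P h) ≈P (f *P (g *P h))
  *P-assoc {zero} f g h [] = begin
    ((f *P g) *P h) []    ≈⟨ trans (*P-[] (f *P g) h) (*-congʳ (*P-[] f g)) ⟩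
    (f [] * g []) * h []  ≈⟨ *-assoc _ _ _ ⟩
    f [] * (g [] * h [])  ≈⟨ trans (*P-[] f (g *P h)) (*-congˡ (*P-[] g h)) ⟨
    (f *P (g *P h)) []    ∎
  *P-assoc {suc n} f g h = ≈P-by-x₀
    (λ I → begin
       ev₀ ((f *P g) *P h) I               ≈⟨ trans (ev₀-*P (f *P g) h I) (*P-congʳ h₀ (ev₀-*P f g) I) ⟩
       ((f₀ *P g₀) *P h₀) I                ≈⟨ *P-assoc f₀ g₀ h₀ I ⟩
       (f₀ *P (g₀ *P h₀)) I                ≈⟨ trans (ev₀-*P f (g *P h) I) (*P-congˡ f₀ (ev₀-*P g h) I) ⟨
       ev₀ (f *P (g *P h)) I               ∎)
    (λ I → begin
       ∂₀ ((f *P g) *P h) I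
         ≈⟨ trans (∂₀-*P (f *P g) h I) (+-cong (*P-congʳ h₁ (ev₀-*P f g) I) (*P-congʳ h₀ (∂₀-*P f g) I)) ⟩
       ((f₀ *P g₀) *P h₁) I + (((f₀ *P g₁) +P (f₁ *P g₀)) *P h₀) I
         ≈⟨ +-cong (*P-assoc f₀ g₀ h₁ I) (trans (*P-distribʳ h₀ (f₀ *P g₁) (f₁ *P g₀) I)
                                               (+-cong (*P-assoc f₀ g₁ h₀ I) (*P-assoc f₁ g₀ h₀ I))) ⟩
       (f₀ *P (g₀ *P h₁)) I + ((f₀ *P (g₁ *P h₀)) I + (f₁ *P (g₀ *P h₀)) I)
         ≈⟨ +-assoc _ _ _ ⟨
       ((f₀ *P (g₀ *P h₁)) I + (f₀ *P (g₁ *P h₀)) I) + (f₁ *P (g₀ *P h₀)) I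
         ≈⟨ +-congʳ (*P-distribˡ f₀ (g₀ *P h₁) (g₁ *P h₀) I) ⟨
       (f₀ *P ((g₀ *P h₁) +P (g₁ *P h₀))) I + (f₁ *P (g₀ *P h₀)) I
         ≈⟨ trans (∂₀-*P f (g *P h) I) (+-cong (*P-congˡ f₀ (∂₀-*P g h) I) (*P-congˡ f₁ (ev₀-*P g h) I)) ⟨
       ∂₀ (f *P (g *P h)) I ∎)
    where
    f₀ = ev₀ f ; f₁ = ∂₀ f ; g₀ = ev₀ g ; g₁ = ∂₀ g ; h₀ = ev₀ h ; h₁ = ∂₀ h

  PolyRing : ℕ → CommutativeRing c ℓ
  PolyRing n = record
    { Carrier = Poly n ; _≈_ = _≈P_ ; _+_ = _+P_ ; _*_ = _*P_ ; -_ = -P_ ; 0# = 0P ; 1# = 1P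
    ; isCommutativeRing = record
      { isRing = record
        { +-isAbelianGroup = record
          { isGroup = record
            { isMonoid = record
              { isSemigroup = record
                { isMagma = record
                  { isEquivalence = record { refl = ≈P-refl ; sym = ≈P-sym ; trans = ≈P-trans }
                  ; ∙-cong = λ f≈ g≈ I → +-cong (f≈ I) (g≈ I) }
                ; assoc = λ f g h I → +-assoc _ _ _ }
              ; identity = (λ f I → +-identityˡ _) , (λ f I → +-identityʳ _) }
            ; inverse = (λ f I → -‿inverseˡ _) , (λ f I → -‿inverseʳ _)
            ; ⁻¹-cong = λ f≈ I → -‿cong (f≈ I) }
          ; comm = λ f g I → +-comm _ _ }
        ; *-cong = *P-cong
        ; *-assoc = *P-assoc
        ; *-identity = *P-identityˡ , *P-identityʳ
        ; distrib = *P-distribˡ , *P-distribʳ }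
      ; *-comm = *P-comm } }

  module PolyRingIdentities (n : ℕ) = RingIdentities (PolyRing n)

  scaleP-*P : ∀ {n} a (f g : Poly n) → (scaleP a f *P g) ≈P scaleP a (f *P g)
  scaleP-*P {zero} a f g [] = trans (*P-[] (scaleP a f) g) (trans (*-assoc _ _ _) (*-congˡ (sym (*P-[] f g))))
  scaleP-*P {suc n} a f g = ≈P-by-x₀
    (λ I → trans (ev₀-*P (scaleP a f) g I) (trans (scaleP-*P a (ev₀ f) (ev₀ g) I) (*-congˡ (sym (ev₀-*P f g I)))))
    (λ I → trans (∂₀-*P (scaleP a f) g I) (trans (+-cong (scaleP-*P a (ev₀ f) (∂₀ g) I) (scaleP-*P a (∂₀ f) (ev₀ g) I))
             (trans (sym (distribˡ a _ _)) (*-congˡ (sym (∂₀-*P f g I))))))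

  *P-scaleP : ∀ {n} a (f g : Poly n) → (f *P scaleP a g) ≈P scaleP a (f *P g)
  *P-scaleP a f g I = trans (*P-comm f (scaleP a g) I) (trans (scaleP-*P a g f I) (*-congˡ (*P-comm g f I)))

  *P-∅ : ∀ {n} (f g : Poly n) → (f *P g) ∅ ≈ f ∅ * g ∅
  *P-∅ {zero}  f g = *P-[] f g
  *P-∅ {suc n} f g = trans (ev₀-*P f g ∅) (*P-∅ (ev₀ f) (ev₀ g))

  guard : Bool → Carrier → Carrier
  guard b x = if b then x else 0#

  guard-cong : ∀ b {x y} → x ≈ y → guard b x ≈ guard b y
  guard-cong true  x≈y = x≈y
  guard-cong false x≈y = refl

  guard-+ : ∀ b x y → guard b (x + y) ≈ guard b x + guard b y
  guard-+ true  x y = refl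
  guard-+ false x y = sym (+-identityˡ 0#)

  restrict : ∀ {n} → Subset n → Poly n → Poly n
  restrict S f I = guard (does (I ⊆? S)) (f I)

  restrict-cong : ∀ {n} (S : Subset n) {f g : Poly n} → f ≈P g → restrict S f ≈P restrict S g
  restrict-cong S f≈g I = guard-cong (does (I ⊆? S)) (f≈g I)

  restrict-+P : ∀ {n} (S : Subset n) (f g : Poly n) → restrict S (f +P g) ≈P (restrict S f +P restrict S g)
  restrict-+P S f g I = guard-+ (does (I ⊆? S)) (f I) (g I)

  restrict-*P : ∀ {n} (S : Subset n) (f g : Poly n) → restrict S (f *P g) ≈P (restrict S f *P restrict S g)
  restrict-*P {zero} [] f g [] = trans (*P-[] f g) (sym (*P-[] (restrict [] f) (restrict [] g)))
  restrict-*P {suc n} (s ∷ S) f g = ≈P-by-x₀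
    (λ I → trans (guard-cong (does (I ⊆? S)) (ev₀-*P f g I))
             (trans (restrict-*P S (ev₀ f) (ev₀ g) I) (sym (ev₀-*P (restrict (s ∷ S) f) (restrict (s ∷ S) g) I))))
    (∂₀-restrict-*P s)
    where
    ∂₀-restrict-*P : ∀ s → ∂₀ (restrict (s ∷ S) (f *P g)) ≈P ∂₀ (restrict (s ∷ S) f *P restrict (s ∷ S) g)
    ∂₀-restrict-*P inside I =
      trans (guard-cong (does (I ⊆? S)) (∂₀-*P f g I))
      (trans (restrict-+P S (ev₀ f *P ∂₀ g) (∂₀ f *P ev₀ g) I)
      (trans (+-cong (restrict-*P S (ev₀ f) (∂₀ g) I) (restrict-*P S (∂₀ f) (ev₀ g) I))
             (sym (∂₀-*P (restrict (inside ∷ S) f) (restrict (inside ∷ S) g) I))))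
    ∂₀-restrict-*P outside I = sym
      (trans (∂₀-*P (restrict (outside ∷ S) f) (restrict (outside ∷ S) g) I)
      (trans (+-cong (*P-zeroʳ (restrict S (ev₀ f)) I) (*P-zeroˡ (restrict S (ev₀ g)) I)) (+-identityˡ 0#)))

  restrict-⊆ : ∀ {n} (S : Subset n) (f : Poly n) {I} → I ⊆ S → restrict S f I ≈ f I
  restrict-⊆ S f {I} I⊆S with I ⊆? S
  ... | yes _   = refl
  ... | no I⊈S = ⊥-elim (I⊈S I⊆S)

  InVars-restrict : ∀ {n} (S : Subset n) (f : Poly n) → InVars S (restrict S f)
  InVars-restrict S f I I⊈S with I ⊆? S
  ... | yes I⊆S = ⊥-elim (I⊈S I⊆S)
  ... | no _    = refl

  InVars⇒≈restrict : ∀ {n} (S : Subset n) {f : Poly n} → InVars S f → f ≈P restrict S f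
  InVars⇒≈restrict S f∈S I with I ⊆? S
  ... | yes _   = refl
  ... | no I⊈S = f∈S I I⊈S

  ≈restrict⇒InVars : ∀ {n} (S : Subset n) {f : Poly n} → f ≈P restrict S f → InVars S f
  ≈restrict⇒InVars S {f} f≈ I I⊈S = trans (f≈ I) (InVars-restrict S f I I⊈S)

  InVars-mono : ∀ {n} {A S : Subset n} {f : Poly n} → A ⊆ S → InVars A f → InVars S f
  InVars-mono A⊆S f∈A I I⊈S = f∈A I (λ I⊆A → I⊈S (A⊆S ∘ I⊆A))

  InVars-*P : ∀ {n} (S : Subset n) {f g : Poly n} → InVars S f → InVars S g → InVars S (f *P g)
  InVars-*P S {f} {g} f∈S g∈S = ≈restrict⇒InVars S
    (≈P-trans (*P-cong (InVars⇒≈restrict S f∈S) (InVars⇒≈restrict S g∈S)) (≈P-sym (restrict-*P S f g)))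

  ^P-cong : ∀ {n} {f g : Poly n} j → f ≈P g → (f ^P j) ≈P (g ^P j)
  ^P-cong zero    f≈g = ≈P-refl
  ^P-cong (suc j) f≈g = *P-cong f≈g (^P-cong j f≈g)

  ev₀-^P : ∀ {n} (t : Poly (suc n)) j → ev₀ (t ^P j) ≈P (ev₀ t ^P j)
  ev₀-^P t zero    = ev₀-1P
  ev₀-^P t (suc j) I = trans (ev₀-*P t (t ^P j) I) (*P-congˡ (ev₀ t) (ev₀-^P t j) I)

  ∂₀-^P : ∀ {n} (t : Poly (suc n)) j → ∂₀ (t ^P suc j) ≈P scaleP (natR cring (suc j)) ((ev₀ t ^P j) *P ∂₀ t)
  ∂₀-^P {n} t zero I = begin
    ∂₀ (t *P 1P) I                          ≈⟨ ∂₀-*P t 1P I ⟩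
    (ev₀ t *P ∂₀ 1P) I + (∂₀ t *P ev₀ 1P) I ≈⟨ +-cong (*P-zeroʳ (ev₀ t) I) (*P-congˡ (∂₀ t) ev₀-1P I) ⟩
    0# + (∂₀ t *P 1P) I                      ≈⟨ trans (+-identityˡ _) (*P-comm (∂₀ t) 1P I) ⟩
    (1P *P ∂₀ t) I                           ≈⟨ trans (*-congʳ (+-identityʳ 1#)) (*-identityˡ _) ⟨
    (1# + 0#) * (1P *P ∂₀ t) I               ∎
  ∂₀-^P {n} t (suc j) I = begin
    ∂₀ (t *P (t ^P suc j)) I
      ≈⟨ ∂₀-*P t (t ^P suc j) I ⟩
    (u *P ∂₀ (t ^P suc j)) I + (∂₀ t *P ev₀ (t ^P suc j)) I
      ≈⟨ +-cong (*P-congˡ u (∂₀-^P t j) I) (*P-congˡ (∂₀ t) (ev₀-^P t (suc j)) I) ⟩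
    (u *P scaleP k ((u ^P j) *P ∂₀ t)) I + (∂₀ t *P (u ^P suc j)) I
      ≈⟨ +-cong (*P-scaleP k u ((u ^P j) *P ∂₀ t) I) (*P-comm (∂₀ t) (u ^P suc j) I) ⟩
    k * (u *P ((u ^P j) *P ∂₀ t)) I + X
      ≈⟨ +-congʳ (*-congˡ (*P-assoc u (u ^P j) (∂₀ t) I)) ⟨
    k * X + X
      ≈⟨ trans (+-congʳ (*-identityˡ X)) (+-comm X (k * X)) ⟨
    1# * X + k * X
      ≈⟨ distribʳ X 1# k ⟨
    (1# + k) * X ∎
    where
    u = ev₀ t
    k = natR cring (suc j)
    X = ((u ^P suc j) *P ∂₀ t) I

  ^P-nilpotent : ∀ n (t : Poly n) → t ∅ ≈ 0# → (t ^P suc n) ≈P 0P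
  ^P-nilpotent zero t t∅≈0 [] = trans (*P-identityʳ t []) t∅≈0
  ^P-nilpotent (suc n) t t∅≈0 = ≈P-by-x₀
    (λ I → trans (ev₀-^P t (suc (suc n)) I) (trans (*P-congˡ (ev₀ t) (^P-nilpotent n (ev₀ t) t∅≈0) I) (*P-zeroʳ (ev₀ t) I)))
    (λ I → trans (∂₀-^P t (suc n) I)
             (trans (*-congˡ (trans (*P-congʳ (∂₀ t) (^P-nilpotent n (ev₀ t) t∅≈0) I) (*P-zeroˡ (∂₀ t) I))) (zeroʳ _)))

  -- h = log f, unfolded via log (f₀ + x₀ f₁) = log f₀ + x₀ f₁ / f₀ (as x₀² = 0).
  IsLog : ∀ n → Poly n → Poly n → Set ℓ
  IsLog zero    f h = (f [] ≈ 1#) × (h [] ≈ 0#)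
  IsLog (suc n) f h = IsLog n (ev₀ f) (ev₀ h) × ((ev₀ f *P ∂₀ h) ≈P ∂₀ f)

  IsLog-resp : ∀ {n} {f f′ h h′ : Poly n} → f ≈P f′ → h ≈P h′ → IsLog n f h → IsLog n f′ h′
  IsLog-resp {zero} f≈ h≈ (f≈1 , h≈0) = trans (sym (f≈ [])) f≈1 , trans (sym (h≈ [])) h≈0
  IsLog-resp {suc n} f≈ h≈ (log₀ , log₁) =
    IsLog-resp (f≈ ∘ (outside ∷_)) (h≈ ∘ (outside ∷_)) log₀ ,
    λ I → trans (*P-cong (≈P-sym (f≈ ∘ (outside ∷_))) (≈P-sym (h≈ ∘ (inside ∷_))) I)
                (trans (log₁ I) (f≈ (inside ∷ I)))

  IsLog-∅ : ∀ {n} {f h : Poly n} → IsLog n f h → (f ∅ ≈ 1#) × (h ∅ ≈ 0#)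
  IsLog-∅ {zero}  log = log
  IsLog-∅ {suc n} log = IsLog-∅ {n} (proj₁ log)

  -- (f₀ + x₀ f₁)⁻¹ = u₀ − x₀ f₁ u₀² where u₀ = f₀⁻¹.
  *P-inverse : ∀ n (f : Poly n) → f ∅ ≈ 1# → Σ (Poly n) λ u → (f *P u) ≈P 1P
  *P-inverse zero    f f∅≈1 = (λ _ → 1#) , λ { [] → trans (*P-[] f (λ _ → 1#)) (trans (*-identityʳ _) f∅≈1) }
  *P-inverse (suc n) f f∅≈1 = (u₀ +x₀ u₁) , ≈P-by-x₀
      (λ I → trans (ev₀-*P f (u₀ +x₀ u₁) I) (trans (f₀u₀≈1 I) (sym (ev₀-1P I))))
      (λ I → trans (∂₀-*P f (u₀ +x₀ u₁) I) (PolyRingIdentities.inverse-derivative n {u = u₀} (∂₀ f) f₀u₀≈1 I))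
    where
    inverse₀ = *P-inverse n (ev₀ f) f∅≈1
    u₀ = proj₁ inverse₀
    f₀u₀≈1 = proj₂ inverse₀
    u₁ = -P ((∂₀ f *P u₀) *P u₀)

  IsLog-unique : ∀ {n} {f h h′ : Poly n} → IsLog n f h → IsLog n f h′ → h ≈P h′
  IsLog-unique {zero}  log log′ [] = trans (proj₂ log) (sym (proj₂ log′))
  IsLog-unique {suc n} {f} log log′ = ≈P-by-x₀ (IsLog-unique (proj₁ log) (proj₁ log′))
      (PolyRingIdentities.unit-cancelˡ n {u = u} (≈P-trans (*P-comm u (ev₀ f)) f₀u≈1)
                                                (≈P-trans (proj₂ log) (≈P-sym (proj₂ log′))))
    where
    inverse₀ = *P-inverse n (ev₀ f) (proj₁ (IsLog-∅ {n} (proj₁ log)))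
    u = proj₁ inverse₀
    f₀u≈1 = proj₂ inverse₀

  IsLog-injective : ∀ {n} {f g h : Poly n} → IsLog n f h → IsLog n g h → f ≈P g
  IsLog-injective {zero}  log log′ [] = trans (proj₁ log) (sym (proj₁ log′))
  IsLog-injective {suc n} {h = h} log log′ = ≈P-by-x₀ f₀≈g₀
      (λ I → trans (sym (proj₂ log I)) (trans (*P-congʳ (∂₀ h) f₀≈g₀ I) (proj₂ log′ I)))
    where
    f₀≈g₀ = IsLog-injective (proj₁ log) (proj₁ log′)

  IsLog-*P : ∀ {n} {f g h k : Poly n} → IsLog n f h → IsLog n g k → IsLog n (f *P g) (h +P k)
  IsLog-*P {zero} {f} {g} (f≈1 , h≈0) (g≈1 , k≈0) =
    trans (*P-[] f g) (trans (*-cong f≈1 g≈1) (*-identityˡ 1#)) , trans (+-cong h≈0 k≈0) (+-identityˡ 0#)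
  IsLog-*P {suc n} {f} {g} {h} {k} (logf₀ , logf₁) (logg₀ , logg₁) =
    IsLog-resp (≈P-sym (ev₀-*P f g)) ≈P-refl (IsLog-*P logf₀ logg₀) , ∂₀-law
    where
    ∂₀-law : (ev₀ (f *P g) *P ∂₀ (h +P k)) ≈P ∂₀ (f *P g)
    ∂₀-law I = begin
      (ev₀ (f *P g) *P (∂₀ h +P ∂₀ k)) I        ≈⟨ *P-congʳ (∂₀ h +P ∂₀ k) (ev₀-*P f g) I ⟩
      ((ev₀ f *P ev₀ g) *P (∂₀ h +P ∂₀ k)) I
                                    ≈⟨ PolyRingIdentities.product-logDerivative n (ev₀ f) (ev₀ g) (∂₀ h) (∂₀ k) I ⟩
      (ev₀ g *P (ev₀ f *P ∂₀ h)) I + (ev₀ f *P (ev₀ g *P ∂₀ k)) I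
                                                ≈⟨ +-cong (*P-congˡ (ev₀ g) logf₁ I) (*P-congˡ (ev₀ f) logg₁ I) ⟩
      (ev₀ g *P ∂₀ f) I + (ev₀ f *P ∂₀ g) I     ≈⟨ trans (+-comm _ _) (+-congˡ (*P-comm (ev₀ g) (∂₀ f) I)) ⟩
      (ev₀ f *P ∂₀ g) I + (∂₀ f *P ev₀ g) I     ≈⟨ ∂₀-*P f g I ⟨
      ∂₀ (f *P g) I                             ∎

  IsLog-restrict : ∀ {n} (S : Subset n) {f h : Poly n} → IsLog n f h → IsLog n (restrict S f) (restrict S h)
  IsLog-restrict {zero}  [] log = log
  IsLog-restrict {suc n} (inside ∷ S) {f} {h} (log₀ , log₁) = IsLog-restrict S log₀ ,
    λ I → trans (sym (restrict-*P S (ev₀ f) (∂₀ h) I)) (guard-cong (does (I ⊆? S)) (log₁ I))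
  IsLog-restrict {suc n} (outside ∷ S) {f} (log₀ , log₁) = IsLog-restrict S log₀ , *P-zeroʳ (restrict S (ev₀ f))

  IsLog-InVars : ∀ {n} (S : Subset n) {f h : Poly n} → InVars S f → IsLog n f h → InVars S h
  IsLog-InVars S f∈S log = ≈restrict⇒InVars S
    (IsLog-unique log (IsLog-resp (≈P-sym (InVars⇒≈restrict S f∈S)) ≈P-refl (IsLog-restrict S log)))

  _-1P : ∀ {n} → Poly n → Poly n
  f -1P = f +P (-P 1P)

  ev₀--1P : ∀ {n} (f : Poly (suc n)) → ev₀ (f -1P) ≈P (ev₀ f -1P)
  ev₀--1P f I = +-congˡ (-‿cong (ev₀-1P I))

  ∂₀--1P : ∀ {n} (f : Poly (suc n)) → ∂₀ (f -1P) ≈P ∂₀ f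
  ∂₀--1P f I = trans (+-congˡ -0#≈0#) (+-identityʳ _)

  -- Since sgn (suc i) = (-1)^i, this is the truncated series Σ_{i<j} (-u)^i for 1/(1+u).
  geometricSum : ∀ {n} → Poly n → ℕ → Poly n
  geometricSum u zero    = 0P
  geometricSum u (suc j) = scaleP (sgn (suc j)) (u ^P j) +P geometricSum u j

  geometricSum-telescopes : ∀ {n} (u : Poly n) m →
    ((1P +P u) *P geometricSum u (suc m)) ≈P (1P +P scaleP (sgn (suc m)) (u ^P suc m))
  geometricSum-telescopes u zero I = begin
    ((1P +P u) *P geometricSum u 1) I  ≈⟨ *P-congˡ (1P +P u) geometricSum-1 I ⟩
    ((1P +P u) *P 1P) I                ≈⟨ *P-identityʳ (1P +P u) I ⟩
    1P I + u I                         ≈⟨ +-congˡ (trans (*-identityˡ _) (*P-identityʳ u I)) ⟨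
    1P I + 1# * (u *P 1P) I            ∎
    where
    geometricSum-1 : geometricSum u 1 ≈P 1P
    geometricSum-1 J = trans (+-identityʳ _) (*-identityˡ _)
  geometricSum-telescopes {n} u (suc m) I = begin
    ((1P +P u) *P geometricSum u (suc (suc m))) I
      ≈⟨ *P-congˡ (1P +P u) geometricSum-suc I ⟩
    ((1P +P u) *P ((-P v) +P geometricSum u (suc m))) I
      ≈⟨ PolyRingIdentities.geometric-step n u v (geometricSum u (suc m)) (geometricSum-telescopes u m) I ⟩
    1P I + - (u *P v) I
      ≈⟨ +-congˡ (-‿cong (*P-scaleP s u (u ^P suc m) I)) ⟩
    1P I + - (s * (u ^P suc (suc m)) I)
      ≈⟨ +-congˡ (-‿distribˡ-* s _) ⟩
    1P I + - s * (u ^P suc (suc m)) I ∎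
    where
    s = sgn (suc m)
    v = scaleP s (u ^P suc m)
    geometricSum-suc : geometricSum u (suc (suc m)) ≈P ((-P v) +P geometricSum u (suc m))
    geometricSum-suc J = +-congʳ (sym (-‿distribˡ-* s ((u ^P suc m) J)))

  ev₀-logSeries : ∀ {n} (f : Poly (suc n)) m → ev₀ (logSeries f m) ≈P logSeries (ev₀ f) m
  ev₀-logSeries f zero    I = refl
  ev₀-logSeries f (suc m) I =
    +-cong (*-congˡ (trans (ev₀-^P (f -1P) (suc m) I) (^P-cong (suc m) (ev₀--1P f) I))) (ev₀-logSeries f m I)

  ∂₀-logSeries : ∀ {n} (f : Poly (suc n)) m → ∂₀ (logSeries f m) ≈P (geometricSum (ev₀ f -1P) m *P ∂₀ f)
  ∂₀-logSeries f zero    I = sym (*P-zeroˡ (∂₀ f) I)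
  ∂₀-logSeries f (suc m) I = begin
    (s * inv (suc m)) * ∂₀ ((f -1P) ^P suc m) I + ∂₀ (logSeries f m) I
      ≈⟨ +-cong (*-congˡ (∂₀-^P (f -1P) m I)) (∂₀-logSeries f m I) ⟩
    (s * inv (suc m)) * (k * ((ev₀ (f -1P) ^P m) *P ∂₀ (f -1P)) I) + (geometricSum u m *P ∂₀ f) I
      ≈⟨ +-congʳ (*-congˡ (*-congˡ (*P-cong (^P-cong m (ev₀--1P f)) (∂₀--1P f) I))) ⟩
    (s * inv (suc m)) * (k * X) + (geometricSum u m *P ∂₀ f) I
      ≈⟨ +-congʳ inv-cancels ⟩
    s * X + (geometricSum u m *P ∂₀ f) I
      ≈⟨ +-congʳ (scaleP-*P s (u ^P m) (∂₀ f) I) ⟨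
    (scaleP s (u ^P m) *P ∂₀ f) I + (geometricSum u m *P ∂₀ f) I
      ≈⟨ *P-distribʳ (∂₀ f) (scaleP s (u ^P m)) (geometricSum u m) I ⟨
    (geometricSum u (suc m) *P ∂₀ f) I ∎
    where
    s = sgn (suc m)
    k = natR cring (suc m)
    u = ev₀ f -1P
    X = ((u ^P m) *P ∂₀ f) I
    inv-cancels : (s * inv (suc m)) * (k * X) ≈ s * X
    inv-cancels = trans (*-assoc _ _ _)
      (*-congˡ (trans (sym (*-assoc _ _ _)) (trans (*-congʳ (inv-law m)) (*-identityˡ X))))

  -- (ev₀ f − 1)^(n+1) = 0 removes the top term from ev₀ of the series, and makes the
  -- geometric sum in ∂₀ of the series an exact inverse of ev₀ f.
  logSeries-IsLog : ∀ n (f : Poly n) → f ∅ ≈ 1# → IsLog n f (logSeries f n)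
  logSeries-IsLog zero    f f∅≈1 = f∅≈1 , refl
  logSeries-IsLog (suc n) f f∅≈1 =
    IsLog-resp ≈P-refl (≈P-sym ev₀-log) (logSeries-IsLog n (ev₀ f) f∅≈1) , ∂₀-law
    where
    u = ev₀ f -1P
    s = sgn (suc n)
    u∅≈0 : u ∅ ≈ 0#
    u∅≈0 = trans (+-cong f∅≈1 (-‿cong (1P-∅ n))) (-‿inverseʳ 1#)
    top-vanishes : ∀ a → scaleP a (u ^P suc n) ≈P 0P
    top-vanishes a J = trans (*-congˡ (^P-nilpotent n u u∅≈0 J)) (zeroʳ a)
    ev₀-log : ev₀ (logSeries f (suc n)) ≈P logSeries (ev₀ f) n
    ev₀-log I = trans (ev₀-logSeries f (suc n) I)
      (trans (+-congʳ (top-vanishes _ I)) (+-identityˡ _))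
    ev₀f≈1+u : ev₀ f ≈P (1P +P u)
    ev₀f≈1+u I = sym (trans (+-comm _ _) (trans (+-assoc _ _ _) (trans (+-congˡ (-‿inverseˡ _)) (+-identityʳ _))))
    ∂₀-law : (ev₀ f *P ∂₀ (logSeries f (suc n))) ≈P ∂₀ f
    ∂₀-law I = begin
      (ev₀ f *P ∂₀ (logSeries f (suc n))) I          ≈⟨ *P-cong ev₀f≈1+u (∂₀-logSeries f (suc n)) I ⟩
      ((1P +P u) *P (geometricSum u (suc n) *P ∂₀ f)) I ≈⟨ *P-assoc (1P +P u) (geometricSum u (suc n)) (∂₀ f) I ⟨
      (((1P +P u) *P geometricSum u (suc n)) *P ∂₀ f) I ≈⟨ *P-congʳ (∂₀ f) (geometricSum-telescopes u n) I ⟩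
      ((1P +P scaleP s (u ^P suc n)) *P ∂₀ f) I
        ≈⟨ *P-congʳ (∂₀ f) (λ J → trans (+-congˡ (top-vanishes s J)) (+-identityʳ _)) I ⟩
      (1P *P ∂₀ f) I                                  ≈⟨ *P-identityˡ (∂₀ f) I ⟩
      ∂₀ f I                                          ∎

  outsideSum-⊆ : ∀ {n} (S : Subset n) (N : Fin n → Poly n) {I} → I ⊆ S → outsideSum S N I ≈ 0#
  outsideSum-⊆ {n} S N {I} I⊆S = sumR-zero (allFin n) term≈0
    where
    term≈0 : ∀ l → (if does (l ∈? S) then 0# else xMul l (N l) I) ≈ 0#
    term≈0 l with l ∈? S | l ∈? I
    ... | yes _  | _       = refl
    ... | no l∉S | yes l∈I = ⊥-elim (l∉S (I⊆S l∈I))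
    ... | no _   | no _    = refl

  restrict-outsideSum : ∀ {n} (S : Subset n) (N : Fin n → Poly n) → restrict S (outsideSum S N) ≈P 0P
  restrict-outsideSum S N I with I ⊆? S
  ... | yes I⊆S = outsideSum-⊆ S N I⊆S
  ... | no _    = refl

  outsideSum-suc : ∀ {n} (S : Subset (suc n)) (N : Fin (suc n) → Poly (suc n)) I →
    outsideSum S N I ≡ (if does (zero ∈? S) then 0# else xMul zero (N zero) I)
                       + sumR (map (λ l → if does (suc l ∈? S) then 0# else xMul (suc l) (N (suc l)) I) (allFin n))
  outsideSum-suc S N I = sumR-allFin-suc (λ l → if does (l ∈? S) then 0# else xMul l (N l) I)

  ─-∅ : ∀ {n} (I : Subset n) → I ─ ∅ ≡ I
  ─-∅ []      = ≡.refl
  ─-∅ (x ∷ I) = ≡.cong (x ∷_) (─-∅ I)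

  -- When 0 ∉ S, the whole x₀-part of R is put into N₀.
  outsideSum-onto : ∀ {n} (S : Subset n) (R : Poly n) → (∀ I → I ⊆ S → R I ≈ 0#) →
                    Σ (Fin n → Poly n) λ N → outsideSum S N ≈P R
  outsideSum-onto []           R R≈0 = (λ ()) , λ { [] → sym (R≈0 [] (λ ())) }
  outsideSum-onto {suc n} (inside ∷ S) R R≈0 = N , ≈P-by-x₀ ev₀-sum ∂₀-sum
    where
    onto₀ = outsideSum-onto S (ev₀ R) (λ I I⊆S → R≈0 (outside ∷ I) (out⊆ I⊆S))
    onto₁ = outsideSum-onto S (∂₀ R) (λ I I⊆S → R≈0 (inside ∷ I) (in⊆in I⊆S))
    N : Fin (suc n) → Poly (suc n)
    N zero    = 0P
    N (suc l) = proj₁ onto₀ l +x₀ proj₁ onto₁ l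
    ev₀-sum : ev₀ (outsideSum (inside ∷ S) N) ≈P ev₀ R
    ev₀-sum I = trans (reflexive (outsideSum-suc _ N _)) (trans (+-identityˡ _) (proj₂ onto₀ I))
    ∂₀-sum : ∂₀ (outsideSum (inside ∷ S) N) ≈P ∂₀ R
    ∂₀-sum I = trans (reflexive (outsideSum-suc _ N _)) (trans (+-identityˡ _) (proj₂ onto₁ I))
  outsideSum-onto {suc n} (outside ∷ S) R R≈0 = N , ≈P-by-x₀ ev₀-sum ∂₀-sum
    where
    onto₀ = outsideSum-onto S (ev₀ R) (λ I I⊆S → R≈0 (outside ∷ I) (out⊆ I⊆S))
    N : Fin (suc n) → Poly (suc n)
    N zero    = ∂₀ R +x₀ 0P
    N (suc l) = proj₁ onto₀ l +x₀ 0P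
    ∂₀-tail≈0 : ∀ I l → (if does (l ∈? S) then 0# else xMul (suc l) (N (suc l)) (inside ∷ I)) ≈ 0#
    ∂₀-tail≈0 I l with does (l ∈? S) | does (l ∈? I)
    ... | true  | _     = refl
    ... | false | true  = refl
    ... | false | false = refl
    ev₀-sum : ev₀ (outsideSum (outside ∷ S) N) ≈P ev₀ R
    ev₀-sum I = trans (reflexive (outsideSum-suc _ N _)) (trans (+-identityˡ _) (proj₂ onto₀ I))
    ∂₀-sum : ∂₀ (outsideSum (outside ∷ S) N) ≈P ∂₀ R
    ∂₀-sum I = trans (reflexive (outsideSum-suc _ N _))
      (trans (+-cong (reflexive (≡.cong (∂₀ R) (─-∅ I))) (sumR-zero (allFin n) (∂₀-tail≈0 I))) (+-identityʳ _))

  ⊆∪-misses-B⇒⊆A : ∀ {n} {A B I : Subset n} → I ⊆ A ∪ B → Empty (I ∩ B) → I ⊆ A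
  ⊆∪-misses-B⇒⊆A {A = A} {B} I⊆A∪B I∩B≡∅ {x} x∈I with x∈p∪q⁻ A B (I⊆A∪B x∈I)
  ... | inj₁ x∈A = x∈A
  ... | inj₂ x∈B = ⊥-elim (I∩B≡∅ (x , x∈p∩q⁺ (x∈I , x∈B)))

  ⊆∪-misses-A⇒⊆B : ∀ {n} {A B I : Subset n} → I ⊆ A ∪ B → Empty (I ∩ A) → I ⊆ B
  ⊆∪-misses-A⇒⊆B {A = A} {B} I⊆A∪B I∩A≡∅ {x} x∈I with x∈p∪q⁻ A B (I⊆A∪B x∈I)
  ... | inj₁ x∈A = ⊥-elim (I∩A≡∅ (x , x∈p∩q⁺ (x∈I , x∈A)))
  ... | inj₂ x∈B = x∈B

  ⊆∪-misses-both⇒≡∅ : ∀ {n} {A B I : Subset n} → I ⊆ A ∪ B → Empty (I ∩ A) → Empty (I ∩ B) → I ≡ ∅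
  ⊆∪-misses-both⇒≡∅ I⊆A∪B I∩A≡∅ I∩B≡∅ =
    Empty-unique λ { (x , x∈I) → I∩A≡∅ (x , x∈p∩q⁺ (x∈I , ⊆∪-misses-B⇒⊆A I⊆A∪B I∩B≡∅ x∈I)) }

  module Disjoint {n} {A B : Subset n} (A∩B≡∅ : Empty (A ∩ B)) where

    meets-B⇒⊈A : ∀ {I} → Nonempty (I ∩ B) → ¬ (I ⊆ A)
    meets-B⇒⊈A {I} (x , x∈I∩B) I⊆A = A∩B≡∅ (x , x∈p∩q⁺ (I⊆A (proj₁ x∈I×B) , proj₂ x∈I×B))
      where x∈I×B = x∈p∩q⁻ I B x∈I∩B

    meets-A⇒⊈B : ∀ {I} → Nonempty (I ∩ A) → ¬ (I ⊆ B)
    meets-A⇒⊈B {I} (x , x∈I∩A) I⊆B = A∩B≡∅ (x , x∈p∩q⁺ (proj₂ x∈I×A , I⊆B (proj₁ x∈I×A)))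
      where x∈I×A = x∈p∩q⁻ I A x∈I∩A

  InVars-scaleP : ∀ {n} (S : Subset n) a {f : Poly n} → InVars S f → InVars S (scaleP a f)
  InVars-scaleP S a f∈S I I⊈S = trans (*-congˡ (f∈S I I⊈S)) (zeroʳ a)

  restrict-∪ : ∀ {n} {A B : Subset n} → Empty (A ∩ B) → (h : Poly n) → h ∅ ≈ 0# →
               (∀ I → I ⊆ A ∪ B → Nonempty (I ∩ A) → Nonempty (I ∩ B) → h I ≈ 0#) →
               restrict (A ∪ B) h ≈P (restrict A h +P restrict B h)
  restrict-∪ {A = A} {B} A∩B≡∅ h h∅≈0 mixed≈0 I with I ⊆? A ∪ B
  ... | no I⊈A∪B = sym (trans (+-cong (InVars-restrict A h I (λ I⊆A → I⊈A∪B (λ x∈I → p⊆p∪q B (I⊆A x∈I))))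
                                      (InVars-restrict B h I (λ I⊆B → I⊈A∪B (λ x∈I → q⊆p∪q A B (I⊆B x∈I)))))
                              (+-identityˡ 0#))
  ... | yes I⊆A∪B = by-meets (nonempty? (I ∩ A)) (nonempty? (I ∩ B))
    where
    open Disjoint A∩B≡∅
    by-meets : Dec (Nonempty (I ∩ A)) → Dec (Nonempty (I ∩ B)) → h I ≈ restrict A h I + restrict B h I
    by-meets (yes meets-A) (yes meets-B) = begin
      h I                                 ≈⟨ mixed≈0 I I⊆A∪B meets-A meets-B ⟩
      0#                                  ≈⟨ +-identityˡ 0# ⟨
      0# + 0#                             ≈⟨ +-cong (InVars-restrict A h I (meets-B⇒⊈A meets-B))
                                                    (InVars-restrict B h I (meets-A⇒⊈B meets-A)) ⟨
      restrict A h I + restrict B h I     ∎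
    by-meets (yes meets-A) (no misses-B) = begin
      h I                                 ≈⟨ restrict-⊆ A h (⊆∪-misses-B⇒⊆A I⊆A∪B misses-B) ⟨
      restrict A h I                      ≈⟨ +-identityʳ _ ⟨
      restrict A h I + 0#                 ≈⟨ +-congˡ (InVars-restrict B h I (meets-A⇒⊈B meets-A)) ⟨
      restrict A h I + restrict B h I     ∎
    by-meets (no misses-A) (yes meets-B) = begin
      h I                                 ≈⟨ restrict-⊆ B h (⊆∪-misses-A⇒⊆B I⊆A∪B misses-A) ⟨
      restrict B h I                      ≈⟨ +-identityˡ _ ⟨
      0# + restrict B h I                 ≈⟨ +-congʳ (InVars-restrict A h I (meets-B⇒⊈A meets-B)) ⟨
      restrict A h I + restrict B h I     ∎
    by-meets (no misses-A) (no misses-B) = begin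
      h I                                 ≈⟨ h∅≈0′ ⟩
      0#                                  ≈⟨ +-identityˡ 0# ⟨
      0# + 0#                             ≈⟨ +-cong (trans (restrict-⊆ A h (⊆∪-misses-B⇒⊆A I⊆A∪B misses-B)) h∅≈0′)
                                                    (trans (restrict-⊆ B h (⊆∪-misses-A⇒⊆B I⊆A∪B misses-A)) h∅≈0′) ⟨
      restrict A h I + restrict B h I     ∎
      where
      h∅≈0′ : h I ≈ 0#
      h∅≈0′ = trans (reflexive (≡.cong h (⊆∪-misses-both⇒≡∅ I⊆A∪B misses-A misses-B))) h∅≈0

  -- Rescaling by the constant terms makes both factors start with 1, so that each has a logarithm.
  IsLog-product-unmixed : ∀ {n} {A B : Subset n} → Empty (A ∩ B) → {f g h : Poly n} →
                          InVars A f → InVars B g → IsLog n (f *P g) h →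
                          ∀ I → Nonempty (I ∩ A) → Nonempty (I ∩ B) → h I ≈ 0#
  IsLog-product-unmixed {n} {A} {B} A∩B≡∅ {f} {g} {h} f∈A g∈B log I meets-A meets-B = begin
    h I                   ≈⟨ h≈h₁+h₂ I ⟩
    h₁ I + h₂ I           ≈⟨ +-cong (IsLog-InVars A (InVars-scaleP A b f∈A) log₁ I (meets-B⇒⊈A meets-B))
                                    (IsLog-InVars B (InVars-scaleP B a g∈B) log₂ I (meets-A⇒⊈B meets-A)) ⟩
    0# + 0#               ≈⟨ +-identityˡ 0# ⟩
    0#                    ∎
    where
    open Disjoint A∩B≡∅
    a = f ∅
    b = g ∅
    ab≈1 : a * b ≈ 1#
    ab≈1 = trans (sym (*P-∅ f g)) (proj₁ (IsLog-∅ log))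
    h₁ = logSeries (scaleP b f) n
    h₂ = logSeries (scaleP a g) n
    log₁ : IsLog n (scaleP b f) h₁
    log₁ = logSeries-IsLog n (scaleP b f) (trans (*-comm b a) ab≈1)
    log₂ : IsLog n (scaleP a g) h₂
    log₂ = logSeries-IsLog n (scaleP a g) ab≈1
    rescaled≈fg : (scaleP b f *P scaleP a g) ≈P (f *P g)
    rescaled≈fg J = begin
      (scaleP b f *P scaleP a g) J   ≈⟨ trans (scaleP-*P b f (scaleP a g) J) (*-congˡ (*P-scaleP a f g J)) ⟩
      b * (a * (f *P g) J)           ≈⟨ *-assoc b a _ ⟨
      (b * a) * (f *P g) J           ≈⟨ *-congʳ (trans (*-comm b a) ab≈1) ⟩
      1# * (f *P g) J                ≈⟨ *-identityˡ _ ⟩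
      (f *P g) J                     ∎
    h≈h₁+h₂ : h ≈P (h₁ +P h₂)
    h≈h₁+h₂ = IsLog-unique log (IsLog-resp rescaled≈fg ≈P-refl (IsLog-*P log₁ log₂))

  mgf-∅ : ∀ {n} (p : Subset n → Carrier) → IsDistribution p → mgf p ∅ ≈ 1#
  mgf-∅ {n} p Σp≈1 = trans (sumR-cong (allSubsets n) ∅⊆-guard) Σp≈1
    where
    ∅⊆-guard : ∀ J → guard (does (∅ ⊆? J)) (p J) ≈ p J
    ∅⊆-guard J = reflexive (≡.cong (λ b → guard b (p J)) (dec-true (∅ ⊆? J) ⊥⊆))

  cumulant-IsLog : ∀ {n} (p : Subset n → Carrier) → IsDistribution p → IsLog n (mgf p) (cumulant p)
  cumulant-IsLog {n} p Σp≈1 = logSeries-IsLog n (mgf p) (mgf-∅ p Σp≈1)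

  MixedCumulantsVanish : ∀ {n} → Subset n → Subset n → (Subset n → Carrier) → Set ℓ
  MixedCumulantsVanish A B p = ∀ I → I ⊆ A ∪ B → Nonempty (I ∩ A) → Nonempty (I ∩ B) → cumulant p I ≈ 0#

  independent⇒mixedCumulantsVanish : ∀ {n} {A B : Subset n} → Empty (A ∩ B) → (p : Subset n → Carrier) →
                                     InIndependenceModel A B p → MixedCumulantsVanish A B p
  independent⇒mixedCumulantsVanish {n} {A} {B} A∩B≡∅ p (Σp≈1 , M₁ , M₂ , N , M₁∈A , M₂∈B , M≈)
                                   I I⊆A∪B meets-A meets-B =
    begin
      cumulant p I                      ≈⟨ restrict-⊆ (A ∪ B) (cumulant p) I⊆A∪B ⟨
      restrict (A ∪ B) (cumulant p) I   ≈⟨ IsLog-product-unmixed A∩B≡∅ M₁∈A M₂∈B log I meets-A meets-B ⟩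
      0#                                ∎
    where
    M₁M₂∈A∪B : InVars (A ∪ B) (M₁ *P M₂)
    M₁M₂∈A∪B = InVars-*P (A ∪ B) (InVars-mono (p⊆p∪q B) M₁∈A) (InVars-mono (q⊆p∪q A B) M₂∈B)
    restrict-M≈M₁M₂ : restrict (A ∪ B) (mgf p) ≈P (M₁ *P M₂)
    restrict-M≈M₁M₂ J = begin
      restrict (A ∪ B) (mgf p) J
        ≈⟨ trans (restrict-cong (A ∪ B) M≈ J) (restrict-+P (A ∪ B) (M₁ *P M₂) (outsideSum (A ∪ B) N) J) ⟩
      restrict (A ∪ B) (M₁ *P M₂) J + restrict (A ∪ B) (outsideSum (A ∪ B) N) J
        ≈⟨ +-cong (sym (InVars⇒≈restrict (A ∪ B) M₁M₂∈A∪B J)) (restrict-outsideSum (A ∪ B) N J) ⟩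
      (M₁ *P M₂) J + 0#
        ≈⟨ +-identityʳ _ ⟩
      (M₁ *P M₂) J ∎
    log : IsLog n (M₁ *P M₂) (restrict (A ∪ B) (cumulant p))
    log = IsLog-resp restrict-M≈M₁M₂ ≈P-refl (IsLog-restrict (A ∪ B) (cumulant-IsLog p Σp≈1))

  mixedCumulantsVanish⇒independent : ∀ {n} {A B : Subset n} → Empty (A ∩ B) → (p : Subset n → Carrier) →
                                     IsDistribution p → MixedCumulantsVanish A B p → InIndependenceModel A B p
  mixedCumulantsVanish⇒independent {n} {A} {B} A∩B≡∅ p Σp≈1 mixed≈0 =
    Σp≈1 , restrict A M , restrict B M , N , InVars-restrict A M , InVars-restrict B M , M≈
    where
    M = mgf p
    K = cumulant p
    log = cumulant-IsLog p Σp≈1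
    K∪ : restrict (A ∪ B) K ≈P (restrict A K +P restrict B K)
    K∪ = restrict-∪ A∩B≡∅ K (proj₂ (IsLog-∅ log)) mixed≈0
    M∪ : restrict (A ∪ B) M ≈P (restrict A M *P restrict B M)
    M∪ = IsLog-injective (IsLog-restrict (A ∪ B) log)
           (IsLog-resp ≈P-refl (≈P-sym K∪) (IsLog-*P (IsLog-restrict A log) (IsLog-restrict B log)))
    R = M +P (-P restrict (A ∪ B) M)
    R≈0 : ∀ I → I ⊆ A ∪ B → R I ≈ 0#
    R≈0 I I⊆A∪B = trans (+-congˡ (-‿cong (restrict-⊆ (A ∪ B) M I⊆A∪B))) (-‿inverseʳ _)
    N = proj₁ (outsideSum-onto (A ∪ B) R R≈0)
    N≈R = proj₂ (outsideSum-onto (A ∪ B) R R≈0)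
    M≈ : M ≈P ((restrict A M *P restrict B M) +P outsideSum (A ∪ B) N)
    M≈ I = begin
      M I                                                 ≈⟨ trans (+-congˡ (-‿inverseˡ _)) (+-identityʳ _) ⟨
      M I + (- restrict (A ∪ B) M I + restrict (A ∪ B) M I) ≈⟨ trans (sym (+-assoc _ _ _)) (+-comm _ _) ⟩
      restrict (A ∪ B) M I + R I                          ≈⟨ +-cong (M∪ I) (sym (N≈R I)) ⟩
      (restrict A M *P restrict B M) I + outsideSum (A ∪ B) N I ∎

proposition3p5 : ∀ {c ℓ} (Q : QAlgebra c ℓ) (n : ℕ) (A B : Subset n) → Empty (A ∩ B) →
    let open Theory Q in
    let open CommutativeRing cring in
    ∀ (p : Subset n → Carrier) → IsDistribution p →
    (InIndependenceModel A B p
    → (∀ I → I ⊆ A ∪ B → Nonempty (I ∩ A) → Nonempty (I ∩ B) → cumulant p I ≈ 0#))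
    × ((∀ I → I ⊆ A ∪ B → Nonempty (I ∩ A) → Nonempty (I ∩ B) → cumulant p I ≈ 0#)
    → InIndependenceModel A B p)
proposition3p5 Q n A B A∩B≡∅ p Σp≈1 =
  independent⇒mixedCumulantsVanish A∩B≡∅ p , mixedCumulantsVanish⇒independent A∩B≡∅ p Σp≈1
  where open Cumulants Q
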